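{- Let $\mathcal{A}$ be a real central hyperplane arrangement. For each subset $\mathcal{B}\subseteq\mathcal{A}$, the groups $MC_{k,\ell}(\mathcal{A};\mathcal{B})$ form a subcomplex of $MC_{*,\ell}(\mathcal{A})$, and there are decompositions \[ MC_{k,\ell}(\mathcal{A})=\bigoplus_{\mathcal{B}\subseteq\mathcal{A}}MC_{k,\ell}(\mathcal{A};\mathcal{B}),\qquad MH_{k,\ell}(\mathcal{A})=\bigoplus_{\mathcal{B}\subseteq\mathcal{A}}MH_{k,\ell}(\mathcal{A};\mathcal{B}). \] Moreover $MC_{k,\ell}(\mathcal{A};\mathcal{B})=MH_{k,\ell}(\mathcal{A};\mathcal{B})=0$ if $\ell<\#\mathcal{B}$.
   Context: An arrangement is a finite set of linear hyperplanes in $\mathbb{R}^d$. For chambers $C,D$, $S(C,D)$ is the set of hyperplanes separating them and $d(C,D)=\#S(C,D)$ is the distance in the tope graph (chambers as vertices, adjacent iff separated by exactly one hyperplane). $MC_{k,\ell}(\mathcal{A})$ is free abelian on proper chains $\vec x=(x_0,\ldots,x_k)$ of chambers ($x_i\ne x_{i+1}$) with $\sum d(x_{i-1},x_i)=\ell$, with differential $\partial=\sum_{i=1}^{k-1}(-1)^{i-1}\partial_i$, $\partial_i$ deleting $x_i$ if $d(x_{i-1},x_{i+1})=d(x_{i-1},x_i)+d(x_i,x_{i+1})$ and $0$ otherwise; $MH_{k,\ell}(\mathcal{A})$ is its homology. For a chain $\vec x$, $S(\vec x)=\bigcup_{i}S(x_{i-1},x_i)$. $MC_{k,\ell}(\mathcal{A};\mathcal{B})$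 is the subgroup spanned by proper chains of length $\ell$ with $S(\vec x)=\mathcal{B}$, and $MH_{k,\ell}(\mathcal{A};\mathcal{B})$ is the homology of $MC_{*,\ell}(\mathcal{A};\mathcal{B})$. -}

module Defs where

open import Data.Nat as ℕ using (ℕ; zero; suc; _<_)
open import Data.Bool as Bool using (Bool; true; false; _xor_; if_then_else_)
open import Data.Fin using (Fin; zero; suc; toℕ; inject₁)
open import Data.Fin.Subset using (Subset; ∣_∣; _∪_; ⊥)
open import Data.Vec as Vec using (Vec; []; _∷_; lookup; zipWith; removeAt)
import Data.Vec.Properties as VecP
open import Data.Integer as ℤ using (ℤ; 0ℤ; 1ℤ; -_; _+_; _*_)
open import Data.List as List using (List; []; _∷_; foldr; map; concatMap; allFin)
open import Data.List.Membership.Propositional using (_∈_)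
open import Data.Product using (Σ; _×_)
open import Data.Unit using (⊤)
open import Relation.Binary.PropositionalEquality using (_≡_; _≢_)
open import Relation.Nullary.Decidable using (⌊_⌋)

-- Combinatorial model of an arrangement with n hyperplanes (indexed by
-- Fin n).  A chamber is recorded by its sign vector, i.e. the subset of
-- hyperplanes on whose positive side it lies.  The arrangement is given
-- by the (duplicate-free) list `ch` of sign vectors of its chambers.

Sep : ∀ {n} → Subset n → Subset n → Subset n
Sep c d = zipWith _xor_ c d

dist : ∀ {n} → Subset n → Subset n → ℕ
dist c d = ∣ Sep c d ∣

-- A chain (x₀,…,x_k) of chambers: a vector of length k+1.
Chain : ℕ → ℕ → Set
Chain n k = Vec (Subset n) (suc k)

len : ∀ {n k} → Chain n k → ℕ
len (x ∷ []) = 0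
len (x ∷ y ∷ ys) = dist x y ℕ.+ len (y ∷ ys)

Sx : ∀ {n k} → Chain n k → Subset n
Sx (x ∷ []) = ⊥
Sx (x ∷ y ∷ ys) = Sep x y ∪ Sx (y ∷ ys)

Proper : ∀ {n k} → List (Subset n) → Chain n k → Set
Proper ch (x ∷ []) = x ∈ ch
Proper ch (x ∷ y ∷ ys) = x ∈ ch × x ≢ y × Proper ch (y ∷ ys)

Σℤ : List ℤ → ℤ
Σℤ = foldr _+_ 0ℤ

allVecs : ∀ {A : Set} → List A → (m : ℕ) → List (Vec A m)
allVecs l zero = [] ∷ []
allVecs l (suc m) = concatMap (λ a → map (a ∷_) (allVecs l m)) l

allSubsets : (n : ℕ) → List (Subset n)
allSubsets n = allVecs (false ∷ true ∷ []) n

-- An element of the free abelian group on chains of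
-- length k+1 is a finitely supported coefficient function; since only
-- finitely many chains of chambers exist, we use functions
-- Chain n k → ℤ, constrained by the support predicates below.

C : ℕ → ℕ → Set
C n k = Chain n k → ℤ

InMC : ∀ {n} → List (Subset n) → (k ℓ : ℕ) → C n k → Set
InMC ch k ℓ f = ∀ x → f x ≢ 0ℤ → Proper ch x × len x ≡ ℓ

InMCB : ∀ {n} → List (Subset n) → (k ℓ : ℕ) → Subset n → C n k → Set
InMCB ch k ℓ B f = ∀ x → f x ≢ 0ℤ → Proper ch x × len x ≡ ℓ × Sx x ≡ B

-- The differential ∂ = Σ_{i=1}^{k-1} (-1)^{i-1} ∂_i on generators,
-- extended linearly.

sgn : ℕ → ℤ
sgn zero = 1ℤ
sgn (suc m) = - sgn m

additive : ∀ {n} → Subset n → Subset n → Subset n → Bool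
additive a b c = ⌊ dist a c ℕ.≟ (dist a b ℕ.+ dist b c) ⌋

δ : ∀ {n m} → Vec (Subset n) m → Vec (Subset n) m → ℤ
δ x y = if ⌊ VecP.≡-dec (VecP.≡-dec Bool._≟_) x y ⌋ then 1ℤ else 0ℤ

-- coefficient of the generator y in ∂(x), x = (x₀,…,x_{k+1});
-- index i : Fin k stands for the interior position p = i+1 ∈ {1,…,k}.
coeff : ∀ {n k} → Chain n (suc k) → Chain n k → ℤ
coeff {k = k} x y = Σℤ (map term (allFin k))
  where
  term : Fin k → ℤ
  term i = if additive (lookup x (inject₁ (inject₁ i)))
                       (lookup x (suc (inject₁ i)))
                       (lookup x (suc (suc i)))
           then sgn (toℕ i) * δ (removeAt x (suc (inject₁ i))) y
           else 0ℤ

-- ∂ : MC_{k+1,ℓ} → MC_{k,ℓ}  (linear extension; f is supported on chains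
-- with entries in ch, so summing over allVecs ch covers its support)
∂ : ∀ {n k} → List (Subset n) → C n (suc k) → C n k
∂ {k = k} ch f y = Σℤ (map (λ x → f x * coeff x y) (allVecs ch (suc (suc k))))

-- cycles (every 0-chain is a cycle: ∂ vanishes on MC_0)
IsCycle : ∀ {n} → List (Subset n) → (k : ℕ) → C n k → Set
IsCycle ch zero f = ⊤
IsCycle ch (suc k) f = ∀ y → ∂ ch f y ≡ 0ℤ

ΣB : ∀ {n k} → (Subset n → C n k) → C n k
ΣB {n} g x = Σℤ (map (λ B → g B x) (allSubsets n))

Subcomplex : ∀ {n} → List (Subset n) → Set
Subcomplex {n} ch = ∀ k ℓ (B : Subset n) (f : C n (suc k)) →
  InMCB ch (suc k) ℓ B f → InMCB ch k ℓ B (∂ ch f)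

-- MC_{k,ℓ}(A) = ⊕_B MC_{k,ℓ}(A;B)  (the sum map is surjective and injective)
ChainDecomposition : ∀ {n} → List (Subset n) → Set
ChainDecomposition {n} ch =
  (∀ k ℓ (f : C n k) → InMC ch k ℓ f →
     Σ (Subset n → C n k) λ g →
       (∀ B → InMCB ch k ℓ B (g B)) × (∀ x → f x ≡ ΣB g x))
  ×
  (∀ k ℓ (g g′ : Subset n → C n k) →
     (∀ B → InMCB ch k ℓ B (g B)) → (∀ B → InMCB ch k ℓ B (g′ B)) →
     (∀ x → ΣB g x ≡ ΣB g′ x) → ∀ B x → g B x ≡ g′ B x)

-- MH_{k,ℓ}(A) = ⊕_B MH_{k,ℓ}(A;B): the canonical map
-- ⊕_B MH_{k,ℓ}(A;B) → MH_{k,ℓ}(A), [g_B]_B ↦ [Σ_B g_B], is surjective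
-- and injective.
HomologyDecomposition : ∀ {n} → List (Subset n) → Set
HomologyDecomposition {n} ch =
  (∀ k ℓ (f : C n k) → InMC ch k ℓ f → IsCycle ch k f →
     Σ (Subset n → C n k) λ g →
       (∀ B → InMCB ch k ℓ B (g B) × IsCycle ch k (g B)) ×
       Σ (C n (suc k)) λ h → InMC ch (suc k) ℓ h ×
         (∀ x → f x ≡ ΣB g x + ∂ ch h x))
  ×
  (∀ k ℓ (g : Subset n → C n k) →
     (∀ B → InMCB ch k ℓ B (g B) × IsCycle ch k (g B)) →
     (Σ (C n (suc k)) λ h → InMC ch (suc k) ℓ h × (∀ x → ΣB g x ≡ ∂ ch h x)) →
     ∀ B → Σ (C n (suc k)) λ h → InMCB ch (suc k) ℓ B h × (∀ x → g B x ≡ ∂ ch h x))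

Vanishing : ∀ {n} → List (Subset n) → Set
Vanishing {n} ch =
  (∀ k ℓ (B : Subset n) → ℓ < ∣ B ∣ → (f : C n k) → InMCB ch k ℓ B f →
     ∀ x → f x ≡ 0ℤ)
  ×
  (∀ k ℓ (B : Subset n) → ℓ < ∣ B ∣ → (f : C n k) → InMCB ch k ℓ B f →
     IsCycle ch k f →
     Σ (C n (suc k)) λ h → InMCB ch (suc k) ℓ B h × (∀ x → f x ≡ ∂ ch h x))

-- The differential only deletes a chamber x_i with
-- d(x_{i-1},x_{i+1}) = d(x_{i-1},x_i) + d(x_i,x_{i+1}).  Hamming distance is
-- additive exactly when no hyperplane separates both consecutive pairs, and
-- then S(x_{i-1},x_{i+1}) = S(x_{i-1},x_i) ∪ S(x_i,x_{i+1}); so the deletion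
-- preserves the length ℓ, the set S(x) and properness.  Hence ∂ respects the
-- grading of chains by B = S(x): restricting a chain to the generators with
-- S(x) = B commutes with ∂, which gives both direct sum decompositions.
-- Vanishing holds because #S(x) ≤ Σ #S(x_{i-1},x_i) = ℓ.
module Submission where

open import Defs
open import Data.Nat using (ℕ)
open import Data.Fin.Subset using (Subset)
open import Data.List using (List)
open import Data.List.Relation.Unary.Unique.Propositional using (Unique)
open import Data.Product using (_×_)

open import Data.Nat as ℕ using (zero; suc; _≤_; _<_; z≤n; s≤s)
import Data.Nat.Properties as ℕP
open import Algebra.Properties.CommutativeSemigroup ℕP.+-commutativeSemigroup
  using (interchange)
open import Data.Bool as Bool using (Bool; true; false; _xor_; _∨_; if_then_else_)
open import Data.Fin using (Fin; zero; suc; toℕ; inject₁)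
open import Data.Fin.Subset using (∣_∣; _∪_)
open import Data.Fin.Subset.Properties using (∣⊥∣≡0; ∪-assoc)
open import Data.Vec using (Vec; []; _∷_; lookup; removeAt)
open import Data.Vec.Properties using (≡-dec; ∷-injectiveʳ)
open import Data.Integer as ℤ using (ℤ; 0ℤ; _+_; _*_)
import Data.Integer.Properties as ℤP
open import Data.List using ([]; _∷_; _++_; map; allFin)
open import Data.List.Properties using (map-∘; map-cong; ++-identityʳ)
open import Data.Product using (∃; _,_; proj₁; proj₂)
open import Data.Unit using (tt)
open import Data.Empty using (⊥-elim)
open import Function using (_∘_)
open import Relation.Binary.PropositionalEquality
open import Relation.Nullary using (Dec; yes; no)
open import Relation.Nullary.Decidable using (⌊_⌋)

bit : Bool → ℕ
bit true  = 1
bit false = 0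

∣b∷p∣≡bit+∣p∣ : ∀ {n} b (p : Subset n) → ∣ b ∷ p ∣ ≡ bit b ℕ.+ ∣ p ∣
∣b∷p∣≡bit+∣p∣ true  p = refl
∣b∷p∣≡bit+∣p∣ false p = refl

bit-xor-triangle : ∀ x y z → bit (x xor z) ≤ bit (x xor y) ℕ.+ bit (y xor z)
bit-xor-triangle true  true  true  = z≤n
bit-xor-triangle true  true  false = s≤s z≤n
bit-xor-triangle true  false true  = z≤n
bit-xor-triangle true  false false = s≤s z≤n
bit-xor-triangle false true  true  = s≤s z≤n
bit-xor-triangle false true  false = z≤n
bit-xor-triangle false false true  = s≤s z≤n
bit-xor-triangle false false false = z≤n

bit-xor-additive : ∀ x y z → bit (x xor z) ≡ bit (x xor y) ℕ.+ bit (y xor z) →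
                   x xor z ≡ (x xor y) ∨ (y xor z)
bit-xor-additive true  true  true  _ = refl
bit-xor-additive true  true  false _ = refl
bit-xor-additive true  false true  ()
bit-xor-additive true  false false _ = refl
bit-xor-additive false true  true  _ = refl
bit-xor-additive false true  false ()
bit-xor-additive false false true  _ = refl
bit-xor-additive false false false _ = refl

bit-∨ : ∀ x y → bit (x ∨ y) ≤ bit x ℕ.+ bit y
bit-∨ true  true  = s≤s z≤n
bit-∨ true  false = s≤s z≤n
bit-∨ false true  = s≤s z≤n
bit-∨ false false = z≤n

+-mono-≤-rigid : ∀ {a b c d} → a ≤ b → c ≤ d → a ℕ.+ c ≡ b ℕ.+ d → a ≡ b × c ≡ d
+-mono-≤-rigid {a} {b} {c} {d} a≤b c≤d eq =
  a≡b , ℕP.+-cancelˡ-≡ a c d (trans eq (cong (ℕ._+ d) (sym a≡b)))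
  where
  a≡b : a ≡ b
  a≡b = ℕP.≤-antisym a≤b
          (ℕP.+-cancelʳ-≤ d b a (subst (_≤ a ℕ.+ d) eq (ℕP.+-monoʳ-≤ a c≤d)))

dist-∷ : ∀ {n} x z (a c : Subset n) → dist (x ∷ a) (z ∷ c) ≡ bit (x xor z) ℕ.+ dist a c
dist-∷ x z a c = ∣b∷p∣≡bit+∣p∣ (x xor z) (Sep a c)

dist-∷-split : ∀ {n} x y z (a b c : Subset n) →
  dist (x ∷ a) (y ∷ b) ℕ.+ dist (y ∷ b) (z ∷ c) ≡
  (bit (x xor y) ℕ.+ bit (y xor z)) ℕ.+ (dist a b ℕ.+ dist b c)
dist-∷-split x y z a b c =
  trans (cong₂ ℕ._+_ (dist-∷ x y a b) (dist-∷ y z b c))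
        (interchange (bit (x xor y)) (dist a b) (bit (y xor z)) (dist b c))

dist-triangle : ∀ {n} (a b c : Subset n) → dist a c ≤ dist a b ℕ.+ dist b c
dist-triangle [] [] [] = z≤n
dist-triangle (x ∷ a) (y ∷ b) (z ∷ c) = begin
  dist (x ∷ a) (z ∷ c)
    ≡⟨ dist-∷ x z a c ⟩
  bit (x xor z) ℕ.+ dist a c
    ≤⟨ ℕP.+-mono-≤ (bit-xor-triangle x y z) (dist-triangle a b c) ⟩
  (bit (x xor y) ℕ.+ bit (y xor z)) ℕ.+ (dist a b ℕ.+ dist b c)
    ≡⟨ dist-∷-split x y z a b c ⟨
  dist (x ∷ a) (y ∷ b) ℕ.+ dist (y ∷ b) (z ∷ c) ∎
  where open ℕP.≤-Reasoning

Sep-additive : ∀ {n} (a b c : Subset n) → dist a c ≡ dist a b ℕ.+ dist b c →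
               Sep a c ≡ Sep a b ∪ Sep b c
Sep-additive [] [] [] _ = refl
Sep-additive (x ∷ a) (y ∷ b) (z ∷ c) xyz =
  cong₂ _∷_ (bit-xor-additive x y z (proj₁ split)) (Sep-additive a b c (proj₂ split))
  where
  split : bit (x xor z) ≡ bit (x xor y) ℕ.+ bit (y xor z) × dist a c ≡ dist a b ℕ.+ dist b c
  split = +-mono-≤-rigid (bit-xor-triangle x y z) (dist-triangle a b c)
            (trans (sym (dist-∷ x z a c)) (trans xyz (dist-∷-split x y z a b c)))

dist-self : ∀ {n} (a : Subset n) → dist a a ≡ 0
dist-self []          = refl
dist-self (true ∷ a)  = dist-self a
dist-self (false ∷ a) = dist-self a

dist≡0⇒≡ : ∀ {n} (a b : Subset n) → dist a b ≡ 0 → a ≡ b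
dist≡0⇒≡ []          []          _  = refl
dist≡0⇒≡ (true ∷ a)  (true ∷ b)  eq = cong (true ∷_) (dist≡0⇒≡ a b eq)
dist≡0⇒≡ (false ∷ a) (false ∷ b) eq = cong (false ∷_) (dist≡0⇒≡ a b eq)
dist≡0⇒≡ (true ∷ a)  (false ∷ b) ()
dist≡0⇒≡ (false ∷ a) (true ∷ b)  ()

∣p∪q∣≤∣p∣+∣q∣ : ∀ {n} (p q : Subset n) → ∣ p ∪ q ∣ ≤ ∣ p ∣ ℕ.+ ∣ q ∣
∣p∪q∣≤∣p∣+∣q∣ [] [] = z≤n
∣p∪q∣≤∣p∣+∣q∣ (x ∷ p) (y ∷ q) = begin
  ∣ (x ∷ p) ∪ (y ∷ q) ∣
    ≡⟨ ∣b∷p∣≡bit+∣p∣ (x ∨ y) (p ∪ q) ⟩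
  bit (x ∨ y) ℕ.+ ∣ p ∪ q ∣
    ≤⟨ ℕP.+-mono-≤ (bit-∨ x y) (∣p∪q∣≤∣p∣+∣q∣ p q) ⟩
  (bit x ℕ.+ bit y) ℕ.+ (∣ p ∣ ℕ.+ ∣ q ∣)
    ≡⟨ interchange (bit x) (bit y) ∣ p ∣ ∣ q ∣ ⟩
  (bit x ℕ.+ ∣ p ∣) ℕ.+ (bit y ℕ.+ ∣ q ∣)
    ≡⟨ cong₂ ℕ._+_ (∣b∷p∣≡bit+∣p∣ x p) (∣b∷p∣≡bit+∣p∣ y q) ⟨
  ∣ x ∷ p ∣ ℕ.+ ∣ y ∷ q ∣ ∎
  where open ℕP.≤-Reasoning

∣Sx∣≤len : ∀ {n k} (x : Chain n k) → ∣ Sx x ∣ ≤ len x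
∣Sx∣≤len {n} (_ ∷ []) = ℕP.≤-reflexive (∣⊥∣≡0 n)
∣Sx∣≤len (x ∷ y ∷ ys) =
  ℕP.≤-trans (∣p∪q∣≤∣p∣+∣q∣ (Sep x y) (Sx (y ∷ ys)))
             (ℕP.+-monoʳ-≤ (dist x y) (∣Sx∣≤len (y ∷ ys)))

_≟ₛ_ : ∀ {n} (p q : Subset n) → Dec (p ≡ q)
_≟ₛ_ = ≡-dec Bool._≟_

dec-true⇒ : ∀ {P : Set} (d : Dec P) → ⌊ d ⌋ ≡ true → P
dec-true⇒ (yes p) _ = p

dec-indicator≢0⇒ : ∀ {P : Set} (d : Dec P) → (if ⌊ d ⌋ then ℤ.1ℤ else 0ℤ) ≢ 0ℤ → P
dec-indicator≢0⇒ (yes p) _   = p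
dec-indicator≢0⇒ (no _)  ≢0 = ⊥-elim (≢0 refl)

*≢0⇒≢0 : ∀ i j → i * j ≢ 0ℤ → i ≢ 0ℤ × j ≢ 0ℤ
*≢0⇒≢0 i j ij≢0 = (λ { refl → ij≢0 refl }) , (λ { refl → ij≢0 (ℤP.*-zeroʳ i) })

additiveAt : ∀ {n k} → Chain n (suc k) → Fin k → Bool
additiveAt x i = additive (lookup x (inject₁ (inject₁ i)))
                          (lookup x (suc (inject₁ i)))
                          (lookup x (suc (suc i)))

deleteAt : ∀ {n k} → Chain n (suc k) → Fin k → Chain n k
deleteAt x i = removeAt x (suc (inject₁ i))

record SameGrade {n k} (ch : List (Subset n)) (x : Chain n (suc k)) (y : Chain n k) : Set where
  field
    len-≡  : len y ≡ len x
    Sx-≡   : Sx y ≡ Sx x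
    proper : Proper ch x → Proper ch y

deleteAt-SameGrade : ∀ {n k} (ch : List (Subset n)) (x : Chain n (suc k)) (i : Fin k) →
  additiveAt x i ≡ true → SameGrade ch x (deleteAt x i)
deleteAt-SameGrade ch (a ∷ b ∷ c ∷ r) zero add = record
  { len-≡  = trans (cong (ℕ._+ len (c ∷ r)) abc)
                   (ℕP.+-assoc (dist a b) (dist b c) (len (c ∷ r)))
  ; Sx-≡   = trans (cong (_∪ Sx (c ∷ r)) (Sep-additive a b c abc))
                   (∪-assoc (Sep a b) (Sep b c) (Sx (c ∷ r)))
  ; proper = λ { (a∈ , a≢b , _ , _ , c-proper) → a∈ , a≢c a≢b , c-proper }
  }
  where
  abc : dist a c ≡ dist a b ℕ.+ dist b c
  abc = dec-true⇒ (dist a c ℕ.≟ (dist a b ℕ.+ dist b c)) add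
  a≢c : a ≢ b → a ≢ c
  a≢c a≢b refl =
    a≢b (dist≡0⇒≡ a b (ℕP.m+n≡0⇒m≡0 (dist a b) (trans (sym abc) (dist-self a))))
deleteAt-SameGrade ch (a ∷ b ∷ c ∷ r) (suc j) add = record
  { len-≡  = cong (dist a b ℕ.+_) len-≡
  ; Sx-≡   = cong (Sep a b ∪_) Sx-≡
  ; proper = λ { (a∈ , a≢b , b-proper) → a∈ , a≢b , proper b-proper }
  }
  where open SameGrade (deleteAt-SameGrade ch (b ∷ c ∷ r) j add)

Σℤ-map-≢0 : ∀ {A : Set} (h : A → ℤ) (l : List A) → Σℤ (map h l) ≢ 0ℤ → ∃ λ a → h a ≢ 0ℤ
Σℤ-map-≢0 h []      s≢0 = ⊥-elim (s≢0 refl)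
Σℤ-map-≢0 h (a ∷ l) s≢0 with h a ℤ.≟ 0ℤ
... | no  ha≢0 = a , ha≢0
... | yes ha≡0 = Σℤ-map-≢0 h l λ s≡0 →
  s≢0 (trans (cong (_+ Σℤ (map h l)) ha≡0) (trans (ℤP.+-identityˡ _) s≡0))

Σℤ-map-≡0 : ∀ {A : Set} {h : A → ℤ} → (∀ a → h a ≡ 0ℤ) → ∀ l → Σℤ (map h l) ≡ 0ℤ
Σℤ-map-≡0 h≡0 []      = refl
Σℤ-map-≡0 h≡0 (a ∷ l) = cong₂ _+_ (h≡0 a) (Σℤ-map-≡0 h≡0 l)

Σℤ-map-++ : ∀ {A : Set} (h : A → ℤ) (xs ys : List A) →
  Σℤ (map h (xs ++ ys)) ≡ Σℤ (map h xs) + Σℤ (map h ys)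
Σℤ-map-++ h []       ys = sym (ℤP.+-identityˡ _)
Σℤ-map-++ h (x ∷ xs) ys =
  trans (cong (h x +_) (Σℤ-map-++ h xs ys)) (sym (ℤP.+-assoc (h x) _ _))

Σℤ-allSubsets-suc : ∀ n (h : Subset (suc n) → ℤ) →
  Σℤ (map h (allSubsets (suc n))) ≡
  Σℤ (map (h ∘ (false ∷_)) (allSubsets n)) + Σℤ (map (h ∘ (true ∷_)) (allSubsets n))
Σℤ-allSubsets-suc n h = begin
  Σℤ (map h (map (false ∷_) A ++ map (true ∷_) A ++ []))
    ≡⟨ cong (λ l → Σℤ (map h (map (false ∷_) A ++ l))) (++-identityʳ _) ⟩
  Σℤ (map h (map (false ∷_) A ++ map (true ∷_) A))
    ≡⟨ Σℤ-map-++ h (map (false ∷_) A) (map (true ∷_) A) ⟩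
  Σℤ (map h (map (false ∷_) A)) + Σℤ (map h (map (true ∷_) A))
    ≡⟨ cong₂ _+_ (cong Σℤ (map-∘ A)) (cong Σℤ (map-∘ A)) ⟨
  Σℤ (map (h ∘ (false ∷_)) A) + Σℤ (map (h ∘ (true ∷_)) A) ∎
  where
  open ≡-Reasoning
  A = allSubsets n

Σℤ-allSubsets-point : ∀ n (h : Subset n → ℤ) B → (∀ B′ → B′ ≢ B → h B′ ≡ 0ℤ) →
  Σℤ (map h (allSubsets n)) ≡ h B
Σℤ-allSubsets-point zero h [] _ = ℤP.+-identityʳ (h [])
Σℤ-allSubsets-point (suc n) h (false ∷ B) h≡0 = begin
  Σℤ (map h (allSubsets (suc n)))
    ≡⟨ Σℤ-allSubsets-suc n h ⟩
  Σℤ (map (h ∘ (false ∷_)) (allSubsets n)) + Σℤ (map (h ∘ (true ∷_)) (allSubsets n))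
    ≡⟨ cong₂ _+_ (Σℤ-allSubsets-point n (h ∘ (false ∷_)) B
                    λ B′ B′≢B → h≡0 _ (B′≢B ∘ ∷-injectiveʳ))
                 (Σℤ-map-≡0 (λ B′ → h≡0 (true ∷ B′) λ ()) (allSubsets n)) ⟩
  h (false ∷ B) + 0ℤ
    ≡⟨ ℤP.+-identityʳ _ ⟩
  h (false ∷ B) ∎
  where open ≡-Reasoning
Σℤ-allSubsets-point (suc n) h (true ∷ B) h≡0 = begin
  Σℤ (map h (allSubsets (suc n)))
    ≡⟨ Σℤ-allSubsets-suc n h ⟩
  Σℤ (map (h ∘ (false ∷_)) (allSubsets n)) + Σℤ (map (h ∘ (true ∷_)) (allSubsets n))
    ≡⟨ cong₂ _+_ (Σℤ-map-≡0 (λ B′ → h≡0 (false ∷ B′) λ ()) (allSubsets n))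
                 (Σℤ-allSubsets-point n (h ∘ (true ∷_)) B
                    λ B′ B′≢B → h≡0 _ (B′≢B ∘ ∷-injectiveʳ)) ⟩
  0ℤ + h (true ∷ B)
    ≡⟨ ℤP.+-identityˡ _ ⟩
  h (true ∷ B) ∎
  where open ≡-Reasoning

term≢0⇒ : ∀ {n m} b s (u y : Vec (Subset n) m) → (if b then s * δ u y else 0ℤ) ≢ 0ℤ →
  b ≡ true × u ≡ y
term≢0⇒ false s u y t≢0 = ⊥-elim (t≢0 refl)
term≢0⇒ true  s u y t≢0 = refl , dec-indicator≢0⇒ (≡-dec _≟ₛ_ u y)
  (λ δ≡0 → t≢0 (trans (cong (s *_) δ≡0) (ℤP.*-zeroʳ s)))

coeff≢0⇒deleteAt : ∀ {n k} (x : Chain n (suc k)) (y : Chain n k) → coeff x y ≢ 0ℤ →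
  ∃ λ i → additiveAt x i ≡ true × deleteAt x i ≡ y
coeff≢0⇒deleteAt {k = k} x y c≢0 =
  let i , tᵢ≢0 = Σℤ-map-≢0 term (allFin k) c≢0
  in  i , term≢0⇒ (additiveAt x i) (sgn (toℕ i)) (deleteAt x i) y tᵢ≢0
  where
  term : Fin k → ℤ
  term i = if additiveAt x i then sgn (toℕ i) * δ (deleteAt x i) y else 0ℤ

coeff≢0⇒SameGrade : ∀ {n k} (ch : List (Subset n)) (x : Chain n (suc k)) (y : Chain n k) →
  coeff x y ≢ 0ℤ → SameGrade ch x y
coeff≢0⇒SameGrade ch x y c≢0 with coeff≢0⇒deleteAt x y c≢0
... | i , add , refl = deleteAt-SameGrade ch x i add

∂≢0⇒support : ∀ {n k} (ch : List (Subset n)) (f : C n (suc k)) y → ∂ ch f y ≢ 0ℤ →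
  ∃ λ x → f x ≢ 0ℤ × coeff x y ≢ 0ℤ
∂≢0⇒support {k = k} ch f y ∂≢0 =
  let x , t≢0 = Σℤ-map-≢0 (λ x → f x * coeff x y) (allVecs ch (suc (suc k))) ∂≢0
  in  x , *≢0⇒≢0 (f x) (coeff x y) t≢0

∂-zero : ∀ {n k} (ch : List (Subset n)) (y : Chain n k) → ∂ ch (λ _ → 0ℤ) y ≡ 0ℤ
∂-zero {k = k} ch y = Σℤ-map-≡0 (λ _ → refl) (allVecs ch (suc (suc k)))

subcomplex : ∀ {n} (ch : List (Subset n)) → Subcomplex ch
subcomplex ch k ℓ B f f∈ y ∂≢0 with ∂≢0⇒support ch f y ∂≢0
... | x , fx≢0 , c≢0 with f∈ x fx≢0
... | x-proper , lenx≡ℓ , Sx≡B = proper x-proper , trans len-≡ lenx≡ℓ , trans Sx-≡ Sx≡B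
  where open SameGrade (coeff≢0⇒SameGrade ch x y c≢0)

keepIf : ∀ {P : Set} → Dec P → ℤ → ℤ
keepIf (yes _) v = v
keepIf (no _)  _ = 0ℤ

keepIf-yes : ∀ {P : Set} (d : Dec P) → P → ∀ v → keepIf d v ≡ v
keepIf-yes (yes _) _ v = refl
keepIf-yes (no ¬p) p v = ⊥-elim (¬p p)

keepIf-≡0 : ∀ {P : Set} (d : Dec P) {v} → v ≡ 0ℤ → keepIf d v ≡ 0ℤ
keepIf-≡0 (yes _) v≡0 = v≡0
keepIf-≡0 (no _)  _   = refl

keepIf-*ˡ : ∀ {P : Set} (d : Dec P) u v → keepIf d u * v ≡ keepIf d (u * v)
keepIf-*ˡ (yes _) u v = refl
keepIf-*ˡ (no _)  u v = refl

Σℤ-keepIf : ∀ {A P : Set} (d : Dec P) (h : A → ℤ) l →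
  Σℤ (map (keepIf d ∘ h) l) ≡ keepIf d (Σℤ (map h l))
Σℤ-keepIf (yes _) h l = refl
Σℤ-keepIf (no _)  h l = Σℤ-map-≡0 (λ _ → refl) l

restrict : ∀ {n k} → Subset n → C n k → C n k
restrict B f x = keepIf (Sx x ≟ₛ B) (f x)

∂-restrict : ∀ {n k} (ch : List (Subset n)) B (f : C n (suc k)) y →
  ∂ ch (restrict B f) y ≡ keepIf (Sx y ≟ₛ B) (∂ ch f y)
∂-restrict {k = k} ch B f y =
  trans (cong Σℤ (map-cong summand (allVecs ch (suc (suc k)))))
        (Σℤ-keepIf (Sx y ≟ₛ B) (λ x → f x * coeff x y) (allVecs ch (suc (suc k))))
  where
  same-grade : ∀ x → keepIf (Sx x ≟ₛ B) (f x * coeff x y) ≡ keepIf (Sx y ≟ₛ B) (f x * coeff x y)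
  same-grade x with coeff x y ℤ.≟ 0ℤ
  ... | no c≢0  = cong (λ S → keepIf (S ≟ₛ B) (f x * coeff x y))
                       (sym (SameGrade.Sx-≡ (coeff≢0⇒SameGrade ch x y c≢0)))
  ... | yes c≡0 = trans (keepIf-≡0 (Sx x ≟ₛ B) fc≡0) (sym (keepIf-≡0 (Sx y ≟ₛ B) fc≡0))
    where
    fc≡0 : f x * coeff x y ≡ 0ℤ
    fc≡0 = trans (cong (f x *_) c≡0) (ℤP.*-zeroʳ (f x))

  summand : ∀ x → restrict B f x * coeff x y ≡ keepIf (Sx y ≟ₛ B) (f x * coeff x y)
  summand x = trans (keepIf-*ˡ (Sx x ≟ₛ B) (f x) (coeff x y)) (same-grade x)

restrict-InMCB : ∀ {n k ℓ} {ch : List (Subset n)} B {f : C n k} → InMC ch k ℓ f →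
  InMCB ch k ℓ B (restrict B f)
restrict-InMCB B f∈ x r≢0 with Sx x ≟ₛ B
... | yes Sx≡B = let x-proper , lenx≡ℓ = f∈ x r≢0 in x-proper , lenx≡ℓ , Sx≡B
... | no _     = ⊥-elim (r≢0 refl)

restrict-IsCycle : ∀ {n} (ch : List (Subset n)) k B {f : C n k} → IsCycle ch k f →
  IsCycle ch k (restrict B f)
restrict-IsCycle ch zero    B _     = tt
restrict-IsCycle ch (suc k) B {f} ∂f≡0 y =
  trans (∂-restrict ch B f y) (keepIf-≡0 (Sx y ≟ₛ B) (∂f≡0 y))

InMC-zero : ∀ {n} (ch : List (Subset n)) k ℓ → InMC ch k ℓ (λ _ → 0ℤ)
InMC-zero ch k ℓ x 0≢0 = ⊥-elim (0≢0 refl)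

InMCB-zero : ∀ {n} (ch : List (Subset n)) k ℓ B → InMCB ch k ℓ B (λ _ → 0ℤ)
InMCB-zero ch k ℓ B x 0≢0 = ⊥-elim (0≢0 refl)

InMCB-outside : ∀ {n k ℓ} {ch : List (Subset n)} {B} {g : C n k} → InMCB ch k ℓ B g →
  ∀ x → Sx x ≢ B → g x ≡ 0ℤ
InMCB-outside g∈ x Sx≢B with _ ℤ.≟ 0ℤ
... | yes gx≡0 = gx≡0
... | no  gx≢0 = let _ , _ , Sx≡B = g∈ x gx≢0 in ⊥-elim (Sx≢B Sx≡B)

ΣB-InMCB : ∀ {n k ℓ} {ch : List (Subset n)} {g : Subset n → C n k} →
  (∀ B → InMCB ch k ℓ B (g B)) → ∀ x → ΣB g x ≡ g (Sx x) x
ΣB-InMCB {n} g∈ x =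
  Σℤ-allSubsets-point n _ (Sx x) λ B B≢Sx → InMCB-outside (g∈ B) x (B≢Sx ∘ sym)

restrict-ΣB : ∀ {n k ℓ} {ch : List (Subset n)} {g : Subset n → C n k} →
  (∀ B → InMCB ch k ℓ B (g B)) → ∀ B x → g B x ≡ restrict B (ΣB g) x
restrict-ΣB g∈ B x with Sx x ≟ₛ B
... | yes refl = sym (ΣB-InMCB g∈ x)
... | no Sx≢B  = InMCB-outside (g∈ B) x Sx≢B

ΣB-restrict : ∀ {n k ℓ} {ch : List (Subset n)} {f : C n k} → InMC ch k ℓ f →
  ∀ x → f x ≡ ΣB (λ B → restrict B f) x
ΣB-restrict {f = f} f∈ x =
  sym (trans (ΣB-InMCB (λ B → restrict-InMCB B f∈) x) (keepIf-yes (Sx x ≟ₛ Sx x) refl (f x)))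

chainDecomposition : ∀ {n} (ch : List (Subset n)) → ChainDecomposition ch
chainDecomposition ch =
  (λ k ℓ f f∈ → (λ B → restrict B f) , (λ B → restrict-InMCB B f∈) , ΣB-restrict f∈) ,
  (λ k ℓ g g′ g∈ g′∈ Σg≡Σg′ B x →
     trans (restrict-ΣB g∈ B x)
           (trans (cong (keepIf (Sx x ≟ₛ B)) (Σg≡Σg′ x)) (sym (restrict-ΣB g′∈ B x))))

homologyDecomposition : ∀ {n} (ch : List (Subset n)) → HomologyDecomposition ch
homologyDecomposition ch =
  (λ k ℓ f f∈ f-cycle →
     (λ B → restrict B f) ,
     (λ B → restrict-InMCB B f∈ , restrict-IsCycle ch k B f-cycle) ,
     (λ _ → 0ℤ) , InMC-zero ch (suc k) ℓ ,
     λ x → trans (ΣB-restrict f∈ x)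
                 (sym (trans (cong (ΣB (λ B → restrict B f) x +_) (∂-zero ch x))
                             (ℤP.+-identityʳ _)))) ,
  (λ { k ℓ g g∈ (h , h∈ , Σg≡∂h) B →
     restrict B h , restrict-InMCB B h∈ ,
     λ x → trans (restrict-ΣB (proj₁ ∘ g∈) B x)
                 (trans (cong (keepIf (Sx x ≟ₛ B)) (Σg≡∂h x)) (sym (∂-restrict ch B h x))) })

InMCB-vanishes : ∀ {n} (ch : List (Subset n)) k ℓ B → ℓ < ∣ B ∣ → (f : C n k) →
  InMCB ch k ℓ B f → ∀ x → f x ≡ 0ℤ
InMCB-vanishes ch k ℓ B ℓ<∣B∣ f f∈ x with f x ℤ.≟ 0ℤ
... | yes fx≡0 = fx≡0
... | no  fx≢0 with f∈ x fx≢0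
... | _ , refl , refl = ⊥-elim (ℕP.<⇒≱ ℓ<∣B∣ (∣Sx∣≤len x))

vanishing : ∀ {n} (ch : List (Subset n)) → Vanishing ch
vanishing ch =
  InMCB-vanishes ch ,
  λ k ℓ B ℓ<∣B∣ f f∈ _ →
    (λ _ → 0ℤ) , InMCB-zero ch (suc k) ℓ B ,
    λ x → trans (InMCB-vanishes ch k ℓ B ℓ<∣B∣ f f∈ x) (sym (∂-zero ch x))

proposition5p6 : (n : ℕ) (ch : List (Subset n)) → Unique ch →
    Subcomplex ch × ChainDecomposition ch × HomologyDecomposition ch × Vanishing ch
proposition5p6 n ch _ =
  subcomplex ch , chainDecomposition ch , homologyDecomposition ch , vanishing ch
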